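{- Let $k\ge 2$, let $\Gamma$ be a simple connected graph, and let $\Gamma'$ be a connected subgraph of $\Gamma$. If $\Gamma'$ has at least $k+1$ vertices, then the defect $k$ group of $\Gamma$ contains a subgroup isomorphic (as a permutation group) to the defect $k$ group of $\Gamma'$. Furthermore, if $\Gamma\setminus\Gamma'$ contains at least one vertex and $\Gamma'$ has at least $k$ vertices, then the defect $k$ group of $\Gamma$ contains a subgroup isomorphic (as a permutation group) to the defect $k-1$ group of $\Gamma'$.
   Context: For a finite simple undirected graph $\Gamma=(V,E)$, the flow semigroup $S_\Gamma$ is the semigroup of transformations of $V$ (acting on the right) generated by the elementary collapsings $e_{uv}$ and $e_{vu}$ for all edges $uv\in E$, where $e_{uv}$ maps $u$ to $v$ and fixes every other vertex. For $1\le k\le |V|-1$ and $V_k\subseteq V$ with $|V_k|=k$, the defect $k$ group $G_{k,V_k}$ is the permutation group on $V\setminus V_k$ generated by the restrictions $s|_{V\setminus V_k}$ of all $s\in S_\Gamma$ with $(V\setminus V_k)s=V\setminus V_k$ and $V_k s\subseteq V\setminus V_k$; for connected $\Gamma$ it is independent of $V_k$ up to permutation isomorphism and is called the defect $k$ group of $\Gamma$. A subgraph $(V',E')$ of $\Gamma$ has $V'\subseteq V$, $E'\subseteq E$, and its defect groups are taken with respect to its own flow semigroup. -}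

module Defs where

open import Data.Nat using (ℕ)
open import Data.Fin using (Fin)
open import Data.Fin.Subset using (Subset; _∈_; _∉_; ∣_∣)
open import Data.Product using (Σ; ∃; _×_; _,_)
open import Relation.Binary.PropositionalEquality using (_≡_; _≢_)
open import Relation.Nullary using (¬_; yes; no)
open import Data.Fin.Properties using (_≟_)
open import Function using (_∘_; id)

record Graph (n : ℕ) : Set₁ where
  field
    Edge     : Fin n → Fin n → Set
    sym      : ∀ {u v} → Edge u v → Edge v u
    irrefl   : ∀ {u} → ¬ Edge u u
open Graph public

data Walk {n : ℕ} (Γ : Graph n) : Fin n → Fin n → Set where
  here : ∀ {u} → Walk Γ u u
  step : ∀ {u v w} → Edge Γ u v → Walk Γ v w → Walk Γ u w

Connected : ∀ {n} → Graph n → Set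
Connected {n} Γ = (u v : Fin n) → Walk Γ u v

-- A subgraph (V',E') of Γ, with V' given (up to renaming) by an injective
-- map ι : Fin m → Fin n, and every edge of Γ' an edge of Γ.
record Subgraph {m n : ℕ} (Γ' : Graph m) (Γ : Graph n) : Set where
  field
    ι        : Fin m → Fin n
    ι-inj    : ∀ {x y} → ι x ≡ ι y → x ≡ y
    ι-edge   : ∀ {u v} → Edge Γ' u v → Edge Γ (ι u) (ι v)
open Subgraph public

-- Transformations of Fin n; acting on the right, so "s then t" is t ∘ s.
Transf : ℕ → Set
Transf n = Fin n → Fin n

collapse : ∀ {n} → Fin n → Fin n → Transf n
collapse u v x with x ≟ u
... | yes _ = v
... | no  _ = x

-- The flow semigroup S_Γ: generated (under composition) by e_uv, e_vu
-- for edges uv (both orientations are covered since Edge is symmetric).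
data InFlow {n : ℕ} (Γ : Graph n) : Transf n → Set where
  gen  : ∀ {u v} → Edge Γ u v → InFlow Γ (collapse u v)
  comp : ∀ {s t} → InFlow Γ s → InFlow Γ t → InFlow Γ (t ∘ s)

IsDefectGen : ∀ {n} → Graph n → Subset n → Transf n → Set
IsDefectGen {n} Γ Vk s =
  InFlow Γ s
  × (∀ x → x ∉ Vk → s x ∉ Vk)
  × (∀ y → y ∉ Vk → ∃ λ x → x ∉ Vk × s x ≡ y)
  × (∀ x → x ∈ Vk → s x ∉ Vk)

-- Elements are
-- represented by transformations of Fin n, only their restriction to
-- V∖V_k being relevant.
data InDefectGroup {n : ℕ} (Γ : Graph n) (Vk : Subset n) : Transf n → Set where
  gen   : ∀ {s} → IsDefectGen Γ Vk s → InDefectGroup Γ Vk s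
  one   : InDefectGroup Γ Vk id
  comp  : ∀ {g h} → InDefectGroup Γ Vk g → InDefectGroup Γ Vk h
        → InDefectGroup Γ Vk (h ∘ g)
  inv   : ∀ {g h} → InDefectGroup Γ Vk g
        → (∀ x → x ∉ Vk → h x ∉ Vk)
        → (∀ x → x ∉ Vk → h (g x) ≡ x)
        → InDefectGroup Γ Vk h
  resp  : ∀ {g h} → InDefectGroup Γ Vk g
        → (∀ x → x ∉ Vk → h x ≡ g x)
        → InDefectGroup Γ Vk h

-- "G_{k,Vk}(Γ) contains a subgroup isomorphic as a permutation group to
-- G_{j,V'j}(Γ')": there is an injection φ of V'∖V'j into V∖Vk such that
-- every g' of the latter group is realised by some g of the former that
-- acts as φ⁻¹ g' φ on the image of φ and fixes V∖Vk outside that image.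
-- (The set of such g is then a subgroup of G_{k,Vk}(Γ), and g ↦ g' is an
-- isomorphism of permutation groups onto G_{j,V'j}(Γ').)
ContainsPermCopy : ∀ {n m} → Graph n → Subset n → Graph m → Subset m → Set
ContainsPermCopy {n} {m} Γ Vk Γ' W =
  Σ (Fin m → Fin n) λ φ →
    (∀ x → x ∉ W → φ x ∉ Vk)
  × (∀ x y → x ∉ W → y ∉ W → φ x ≡ φ y → x ≡ y)
  × (∀ g' → InDefectGroup Γ' W g' →
       Σ (Transf n) λ g →
         InDefectGroup Γ Vk g
       × (∀ x → x ∉ W → g (φ x) ≡ φ (g' x))
       × (∀ y → y ∉ Vk → (∀ x → x ∉ W → φ x ≢ y) → g y ≡ y))

-- Let U ⊆ V be the image of W under the embedding ι of Γ' into Γ (for the defect k − 1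
-- statement, together with a vertex w outside Γ' adjacent to Γ'). Every flow element of Γ'
-- extends to one of Γ that commutes with ι and fixes the vertices outside Γ'; preceded by the
-- collapsing of w into Γ' when w is added, the extension of a generator of the defect group of Γ'
-- at W is a generator of the defect group of Γ at U. Since Γ is connected, that group embeds into
-- the one at any V_k with |V_k| = |U|: the flow semigroup contains maps t : V → V ∖ U and
-- ψ : V → V ∖ V_k that are bijective on V ∖ V_k and on V ∖ U respectively (retract V onto a set
-- along walks, then slide its points one at a time along walks), and r ↦ (ψ r t)(ψ t)⁻¹ carries
-- generators at U to elements of the group at V_k acting as ψ r ψ⁻¹. Composing the two copies
-- gives the theorem.

module Submission where

open import Defs hiding (sym)
open import Data.Nat using (ℕ; zero; suc; _≤_; _<_; _+_; _∸_; z≤n; s≤s)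
open import Data.Nat.Properties using (≤-<-trans; <-irrefl; +-comm)
open import Data.Nat.Induction using (<-wellFounded)
open import Induction.WellFounded using (Acc; acc)
open import Data.Fin using (Fin; zero; suc)
open import Data.Fin.Properties using (_≟_; any?; ¬∀⟶∃¬; suc-injective)
open import Data.Fin.Subset
  using (Subset; inside; outside; _∈_; _∉_; _⊆_; _∪_; _─_; _-_; ⁅_⁆; ⊥; ∁; ∣_∣; Nonempty)
open import Data.Fin.Subset.Properties
open import Data.Vec using ([]; _∷_; here; there)
open import Data.List using (List; []; _∷_; allFin)
open import Data.List.Membership.Propositional.Properties using (∈-allFin)
open import Data.List.Relation.Unary.All as All using (All; []; _∷_)
open import Data.Product using (Σ; ∃; _×_; _,_; proj₁; proj₂)
open import Data.Sum using (_⊎_; inj₁; inj₂)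
open import Data.Empty using (⊥-elim)
open import Function using (_∘_; id; case_of_)
open import Relation.Binary.PropositionalEquality
  using (_≡_; _≢_; refl; sym; trans; cong; subst)
open import Relation.Nullary using (¬_; Dec; yes; no)
open import Relation.Nullary.Decidable using (_×-dec_; ¬?)

private
  variable
    n m : ℕ

-- Finite sets of vertices

x∈p─q⇒x∉q : ∀ {p q : Subset n} {x} → x ∈ p ─ q → x ∉ q
x∈p─q⇒x∉q {p = inside ∷ p} {outside ∷ q} here ()
x∈p─q⇒x∉q {p = _ ∷ p} {_ ∷ q} (there x∈p─q) (there x∈q) = x∈p─q⇒x∉q x∈p─q x∈q

x∉p⇒∣⁅x⁆∪p∣≡1+∣p∣ : ∀ {p : Subset n} {x} → x ∉ p → ∣ ⁅ x ⁆ ∪ p ∣ ≡ suc ∣ p ∣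
x∉p⇒∣⁅x⁆∪p∣≡1+∣p∣ {p = inside ∷ p} {zero} x∉p = ⊥-elim (x∉p here)
x∉p⇒∣⁅x⁆∪p∣≡1+∣p∣ {p = outside ∷ p} {zero} x∉p = cong (suc ∘ ∣_∣) (∪-identityˡ p)
x∉p⇒∣⁅x⁆∪p∣≡1+∣p∣ {p = inside ∷ p} {suc x} x∉p = cong suc (x∉p⇒∣⁅x⁆∪p∣≡1+∣p∣ (x∉p ∘ there))
x∉p⇒∣⁅x⁆∪p∣≡1+∣p∣ {p = outside ∷ p} {suc x} x∉p = x∉p⇒∣⁅x⁆∪p∣≡1+∣p∣ (x∉p ∘ there)

x∈p⇒1+∣p-x∣≡∣p∣ : ∀ {p : Subset n} {x} → x ∈ p → suc ∣ p - x ∣ ≡ ∣ p ∣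
x∈p⇒1+∣p-x∣≡∣p∣ {p = inside ∷ p} here = cong (suc ∘ ∣_∣) (p─⊥≡p p)
x∈p⇒1+∣p-x∣≡∣p∣ {p = inside ∷ p} (there x∈p) = cong suc (x∈p⇒1+∣p-x∣≡∣p∣ x∈p)
x∈p⇒1+∣p-x∣≡∣p∣ {p = outside ∷ p} (there x∈p) = x∈p⇒1+∣p-x∣≡∣p∣ x∈p

x∈p⇒0<∣p∣ : ∀ {p : Subset n} {x} → x ∈ p → 0 < ∣ p ∣
x∈p⇒0<∣p∣ x∈p = ≤-<-trans z≤n (x∈p⇒∣p-x∣<∣p∣ x∈p)

0<∣p∣⇒Nonempty : ∀ {p : Subset n} → 0 < ∣ p ∣ → Nonempty p
0<∣p∣⇒Nonempty {n} {p} 0<∣p∣ with nonempty? p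
... | yes ne = ne
... | no ∅ = ⊥-elim (<-irrefl (sym (trans (cong ∣_∣ (Empty-unique ∅)) (∣⊥∣≡0 n))) 0<∣p∣)

x∉p⇒∣p∣<n : ∀ {p : Subset n} {x} → x ∉ p → ∣ p ∣ < n
x∉p⇒∣p∣<n {n} {p} x∉p = subst (∣ p ∣ <_) (∣⊤∣≡n n) (p⊂q⇒∣p∣<∣q∣ (⊆⊤ , _ , ∈⊤ , x∉p))

∣p∣<n⇒∃∉ : ∀ {p : Subset n} → ∣ p ∣ < n → ∃ λ x → x ∉ p
∣p∣<n⇒∃∉ {n} {p} ∣p∣<n = ¬∀⟶∃¬ n (_∈ p) (_∈? p) λ all∈ →
  <-irrefl (trans (cong ∣_∣ (⊆-antisym ⊆⊤ (λ _ → all∈ _))) (∣⊤∣≡n n)) ∣p∣<n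

x≢y∧x∉p⇒x∉⁅y⁆∪p : ∀ {p : Subset n} {x y} → x ≢ y → x ∉ p → x ∉ ⁅ y ⁆ ∪ p
x≢y∧x∉p⇒x∉⁅y⁆∪p {p = p} {y = y} x≢y x∉p x∈ with x∈p∪q⁻ ⁅ y ⁆ p x∈
... | inj₁ x∈⁅y⁆ = x≢y (x∈⁅y⁆⇒x≡y y x∈⁅y⁆)
... | inj₂ x∈p = x∉p x∈p

Empty[p─q]⇒p⊆q : ∀ {p q : Subset n} → ¬ Nonempty (p ─ q) → p ⊆ q
Empty[p─q]⇒p⊆q {q = q} ∅ {x} x∈p with x ∈? q
... | yes x∈q = x∈q
... | no x∉q = ⊥-elim (∅ (x , x∈p∧x∉q⇒x∈p─q x∈p x∉q))

p⊆q∧∣p∣≡∣q∣⇒q⊆p : ∀ {p q : Subset n} → p ⊆ q → ∣ p ∣ ≡ ∣ q ∣ → q ⊆ p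
p⊆q∧∣p∣≡∣q∣⇒q⊆p {p = p} p⊆q ∣p∣≡∣q∣ {x} x∈q with x ∈? p
... | yes x∈p = x∈p
... | no x∉p = ⊥-elim (<-irrefl ∣p∣≡∣q∣ (p⊂q⇒∣p∣<∣q∣ (p⊆q , x , x∈q , x∉p)))

image : (Fin m → Fin n) → Subset m → Subset n
image f []            = ⊥
image f (outside ∷ p) = image (f ∘ suc) p
image f (inside ∷ p)  = ⁅ f zero ⁆ ∪ image (f ∘ suc) p

∈-image⁺ : ∀ (f : Fin m → Fin n) {p x} → x ∈ p → f x ∈ image f p
∈-image⁺ f {inside ∷ p} here = x∈p∪q⁺ (inj₁ (x∈⁅x⁆ (f zero)))
∈-image⁺ f {inside ∷ p} (there x∈p) = x∈p∪q⁺ (inj₂ (∈-image⁺ (f ∘ suc) x∈p))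
∈-image⁺ f {outside ∷ p} (there x∈p) = ∈-image⁺ (f ∘ suc) x∈p

∈-image⁻ : ∀ (f : Fin m → Fin n) {p y} → y ∈ image f p → ∃ λ x → x ∈ p × f x ≡ y
∈-image⁻ f {[]} y∈ = ⊥-elim (∉⊥ y∈)
∈-image⁻ f {outside ∷ p} y∈ with ∈-image⁻ (f ∘ suc) y∈
... | x , x∈p , fx≡y = suc x , there x∈p , fx≡y
∈-image⁻ f {inside ∷ p} {y} y∈ with x∈p∪q⁻ ⁅ f zero ⁆ (image (f ∘ suc) p) y∈
... | inj₁ y∈⁅f0⁆ = zero , here , sym (x∈⁅y⁆⇒x≡y _ y∈⁅f0⁆)
... | inj₂ y∈img with ∈-image⁻ (f ∘ suc) y∈img
...   | x , x∈p , fx≡y = suc x , there x∈p , fx≡y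

∣image∣≡∣p∣ : ∀ {f : Fin m → Fin n} → (∀ {x y} → f x ≡ f y → x ≡ y) →
             ∀ (p : Subset m) → ∣ image f p ∣ ≡ ∣ p ∣
∣image∣≡∣p∣ {n = n} f-inj [] = ∣⊥∣≡0 n
∣image∣≡∣p∣ f-inj (outside ∷ p) = ∣image∣≡∣p∣ (λ e → suc-injective (f-inj e)) p
∣image∣≡∣p∣ {f = f} f-inj (inside ∷ p) =
  trans (x∉p⇒∣⁅x⁆∪p∣≡1+∣p∣ {p = image (f ∘ suc) p} f0∉)
        (cong suc (∣image∣≡∣p∣ (λ e → suc-injective (f-inj e)) p))
  where
  f0∉ : f zero ∉ image (f ∘ suc) p
  f0∉ f0∈ with ∈-image⁻ (f ∘ suc) {p} f0∈
  ... | x , _ , e with f-inj e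
  ...   | ()

_[_↦_] : Subset n → Fin n → Fin n → Subset n
P [ u ↦ v ] = ⁅ v ⁆ ∪ (P - u)

∈-↦-target : ∀ (P : Subset n) u v → v ∈ P [ u ↦ v ]
∈-↦-target P u v = x∈p∪q⁺ (inj₁ (x∈⁅x⁆ v))

∈-↦-kept : ∀ {P : Subset n} {u x} v → x ∈ P → x ≢ u → x ∈ P [ u ↦ v ]
∈-↦-kept v x∈P x≢u = x∈p∪q⁺ (inj₂ (x∈p∧x≢y⇒x∈p-y x∈P x≢u))

∈-↦⁻ : ∀ {P : Subset n} {u v y} → y ∈ P [ u ↦ v ] → y ≡ v ⊎ (y ∈ P × y ≢ u)
∈-↦⁻ {P = P} {u} {v} y∈ with x∈p∪q⁻ ⁅ v ⁆ (P - u) y∈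
... | inj₁ y∈⁅v⁆ = inj₁ (x∈⁅y⁆⇒x≡y v y∈⁅v⁆)
... | inj₂ y∈P-u = inj₂ (p─q⊆p P ⁅ u ⁆ y∈P-u , x∉⁅y⁆⇒x≢y (x∈p─q⇒x∉q y∈P-u))

∣P[u↦v]∣≡∣P∣ : ∀ {P : Subset n} {u v} → u ∈ P → v ∉ P → ∣ P [ u ↦ v ] ∣ ≡ ∣ P ∣
∣P[u↦v]∣≡∣P∣ {P = P} {u} u∈P v∉P =
  trans (x∉p⇒∣⁅x⁆∪p∣≡1+∣p∣ {p = P - u} (v∉P ∘ p─q⊆p P ⁅ u ⁆)) (x∈p⇒1+∣p-x∣≡∣p∣ u∈P)

P[u↦w][w↦v]≡P[u↦v] : ∀ {P : Subset n} {u w v} → w ∉ P → P [ u ↦ w ] [ w ↦ v ] ≡ P [ u ↦ v ]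
P[u↦w][w↦v]≡P[u↦v] {P = P} {u} {w} {v} w∉P = ⊆-antisym lhs⊆rhs rhs⊆lhs
  where
  lhs⊆rhs : P [ u ↦ w ] [ w ↦ v ] ⊆ P [ u ↦ v ]
  lhs⊆rhs y∈ with ∈-↦⁻ y∈
  ... | inj₁ refl = ∈-↦-target P u v
  ... | inj₂ (y∈P[u↦w] , y≢w) with ∈-↦⁻ y∈P[u↦w]
  ...   | inj₁ y≡w = ⊥-elim (y≢w y≡w)
  ...   | inj₂ (y∈P , y≢u) = ∈-↦-kept v y∈P y≢u

  rhs⊆lhs : P [ u ↦ v ] ⊆ P [ u ↦ w ] [ w ↦ v ]
  rhs⊆lhs y∈ with ∈-↦⁻ y∈
  ... | inj₁ refl = ∈-↦-target (P [ u ↦ w ]) w v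
  ... | inj₂ (y∈P , y≢u) = ∈-↦-kept v (∈-↦-kept w y∈P y≢u) λ { refl → w∉P y∈P }

P[w↦v][u↦w]≡P[u↦v] : ∀ {P : Subset n} {u w v} → u ∈ P → w ∈ P → v ∉ P → u ≢ w →
                     P [ w ↦ v ] [ u ↦ w ] ≡ P [ u ↦ v ]
P[w↦v][u↦w]≡P[u↦v] {P = P} {u} {w} {v} u∈P w∈P v∉P u≢w = ⊆-antisym lhs⊆rhs rhs⊆lhs
  where
  lhs⊆rhs : P [ w ↦ v ] [ u ↦ w ] ⊆ P [ u ↦ v ]
  lhs⊆rhs y∈ with ∈-↦⁻ y∈
  ... | inj₁ refl = ∈-↦-kept v w∈P (u≢w ∘ sym)
  ... | inj₂ (y∈P[w↦v] , y≢u) with ∈-↦⁻ y∈P[w↦v]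
  ...   | inj₁ refl = ∈-↦-target P u v
  ...   | inj₂ (y∈P , _) = ∈-↦-kept v y∈P y≢u

  rhs⊆lhs : P [ u ↦ v ] ⊆ P [ w ↦ v ] [ u ↦ w ]
  rhs⊆lhs y∈ with ∈-↦⁻ y∈
  ... | inj₁ refl = ∈-↦-kept w (∈-↦-target P w v) λ { refl → v∉P u∈P }
  rhs⊆lhs {y} y∈ | inj₂ (y∈P , y≢u) with y ≟ w
  ... | yes refl = ∈-↦-target (P [ w ↦ v ]) u y
  ... | no y≢w = ∈-↦-kept w (∈-↦-kept v y∈P y≢w) y≢u

-- Moving sets of vertices in the flow semigroup

collapse-source : ∀ (u v : Fin n) → collapse u v u ≡ v
collapse-source u v with u ≟ u
... | yes _ = refl
... | no u≢u = ⊥-elim (u≢u refl)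

collapse-fixes : ∀ {u x : Fin n} v → x ≢ u → collapse u v x ≡ x
collapse-fixes {u = u} {x} v x≢u with x ≟ u
... | yes x≡u = ⊥-elim (x≢u x≡u)
... | no _ = refl

data InFlow¹ (Γ : Graph n) : Transf n → Set where
  identity : InFlow¹ Γ id
  flow     : ∀ {s} → InFlow Γ s → InFlow¹ Γ s

InFlow¹-comp : ∀ {Γ : Graph n} {s t} → InFlow¹ Γ s → InFlow¹ Γ t → InFlow¹ Γ (t ∘ s)
InFlow¹-comp identity t = t
InFlow¹-comp (flow s) identity = flow s
InFlow¹-comp (flow s) (flow t) = flow (comp s t)

Surjects : Transf n → (Fin n → Set) → (Fin n → Set) → Set
Surjects t P R = ∀ y → R y → ∃ λ x → P x × t x ≡ y

Surjects-comp : ∀ {s t : Transf n} {P Q R} → Surjects s P Q → Surjects t Q R → Surjects (t ∘ s) P R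
Surjects-comp {s = s} {t} s-onto t-onto y Ry =
  let z , Qz , tz≡y = t-onto y Ry
      x , Px , sx≡z = s-onto z Qz
  in  x , Px , trans (cong t sx≡z) tz≡y

record BijectionOn (t : Transf n) (P R : Fin n → Set) : Set where
  field
    into      : ∀ {x} → P x → R (t x)
    onto      : Surjects t P R
    injective : ∀ {x y} → P x → P y → t x ≡ t y → x ≡ y
open BijectionOn

BijectionOn-fixed : ∀ {t : Transf n} {P} → (∀ {x} → P x → t x ≡ x) → BijectionOn t P P
BijectionOn-fixed {P = P} fix = record
  { into      = λ {x} Px → subst P (sym (fix Px)) Px
  ; onto      = λ y Py → y , Py , fix Py
  ; injective = λ Px Py e → trans (sym (fix Px)) (trans e (fix Py))
  }

BijectionOn-comp : ∀ {s t : Transf n} {P Q R} →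
                   BijectionOn s P Q → BijectionOn t Q R → BijectionOn (t ∘ s) P R
BijectionOn-comp {s = s} {t} bs bt = record
  { into      = into bt ∘ into bs
  ; onto      = Surjects-comp (onto bs) (onto bt)
  ; injective = λ Px Py e → injective bs Px Py (injective bt (into bs Px) (into bs Py) e)
  }

BijectionOn-∁ : ∀ {t : Transf n} {V U} →
                BijectionOn t (_∈ ∁ V) (_∈ ∁ U) → BijectionOn t (_∉ V) (_∉ U)
BijectionOn-∁ bij = record
  { into      = x∈∁p⇒x∉p ∘ into bij ∘ x∉p⇒x∈∁p
  ; onto      = λ y y∉U → let x , x∈∁V , tx≡y = onto bij y (x∉p⇒x∈∁p y∉U)
                         in  x , x∈∁p⇒x∉p x∈∁V , tx≡y
  ; injective = λ x∉V y∉V → injective bij (x∉p⇒x∈∁p x∉V) (x∉p⇒x∈∁p y∉V)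
  }

InFlow¹⇒InFlow : ∀ {Γ : Graph n} {s} → InFlow¹ Γ s → ¬ (∀ x → s x ≡ x) → InFlow Γ s
InFlow¹⇒InFlow identity s≢id = ⊥-elim (s≢id λ _ → refl)
InFlow¹⇒InFlow (flow s) _ = s

module _ {Γ : Graph n} where

  walk-into : ∀ {A : Subset n} {u v} → Walk Γ u v → v ∈ A →
              ∃ λ c → InFlow¹ Γ c × (∀ {x} → x ∈ A → c x ≡ x) × c u ∈ A
  walk-into here v∈A = id , identity , (λ _ → refl) , v∈A
  walk-into {A = A} {u} (step {v = w} u~w walk) v∈A with u ∈? A
  ... | yes u∈A = id , identity , (λ _ → refl) , u∈A
  ... | no u∉A with walk-into walk v∈A
  ...   | c , c-flow , c-fix , cw∈A =
    c ∘ collapse u w , InFlow¹-comp (flow (gen u~w)) c-flow , fix ,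
    subst (λ z → c z ∈ A) (sym (collapse-source u w)) cw∈A
    where
    fix : ∀ {x} → x ∈ A → c (collapse u w x) ≡ x
    fix x∈A = trans (cong c (collapse-fixes w λ { refl → u∉A x∈A })) (c-fix x∈A)

  retraction : Connected Γ → ∀ {A : Subset n} → Nonempty A →
               ∃ λ r → InFlow¹ Γ r × (∀ {x} → x ∈ A → r x ≡ x) × (∀ y → r y ∈ A)
  retraction conn {A} (a , a∈A) =
    let r , r-flow , r-fix , r∈A = retractOn (allFin n)
    in  r , r-flow , r-fix , λ y → All.lookup r∈A (∈-allFin y)
    where
    retractOn : (L : List (Fin n)) →
                ∃ λ r → InFlow¹ Γ r × (∀ {x} → x ∈ A → r x ≡ x) × All (λ y → r y ∈ A) L
    retractOn [] = id , identity , (λ _ → refl) , []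
    retractOn (y ∷ L) with retractOn L
    ... | r , r-flow , r-fix , rL∈A with walk-into (conn (r y) a) a∈A
    ...   | c , c-flow , c-fix , cry∈A =
      c ∘ r , InFlow¹-comp r-flow c-flow , (λ x∈A → trans (cong c (r-fix x∈A)) (c-fix x∈A)) ,
      cry∈A ∷ All.map (λ rz∈A → subst (_∈ A) (sym (c-fix rz∈A)) rz∈A) rL∈A

  infix 4 _⇝_
  _⇝_ : Subset n → Subset n → Set
  P ⇝ R = ∃ λ t → InFlow¹ Γ t × BijectionOn t (_∈ P) (_∈ R)

  ⇝-reflexive : ∀ {P R : Subset n} → P ≡ R → P ⇝ R
  ⇝-reflexive refl = id , identity , BijectionOn-fixed (λ _ → refl)

  ⇝-trans : ∀ {P Q R : Subset n} → P ⇝ Q → Q ⇝ R → P ⇝ R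
  ⇝-trans (s , s-flow , s-bij) (t , t-flow , t-bij) =
    t ∘ s , InFlow¹-comp s-flow t-flow , BijectionOn-comp s-bij t-bij

  collapse-⇝ : ∀ {P : Subset n} {u v} → Edge Γ u v → u ∈ P → v ∉ P → P ⇝ P [ u ↦ v ]
  collapse-⇝ {P} {u} {v} u~v u∈P v∉P =
    collapse u v , flow (gen u~v) ,
    record { into = into′ ; onto = onto′ ; injective = injective′ }
    where
    into′ : ∀ {x} → x ∈ P → collapse u v x ∈ P [ u ↦ v ]
    into′ {x} x∈P with x ≟ u
    ... | yes refl = ∈-↦-target P u v
    ... | no x≢u = ∈-↦-kept v x∈P x≢u

    onto′ : Surjects (collapse u v) (_∈ P) (_∈ P [ u ↦ v ])
    onto′ y y∈ with ∈-↦⁻ y∈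
    ... | inj₁ refl = u , u∈P , collapse-source u v
    ... | inj₂ (y∈P , y≢u) = _ , y∈P , collapse-fixes v y≢u

    injective′ : ∀ {x y} → x ∈ P → y ∈ P → collapse u v x ≡ collapse u v y → x ≡ y
    injective′ {x} {y} x∈P y∈P cx≡cy with x ≟ u | y ≟ u
    ... | yes refl | yes refl = refl
    ... | yes refl | no _     = ⊥-elim (v∉P (subst (_∈ P) (sym cx≡cy) y∈P))
    ... | no _     | yes refl = ⊥-elim (v∉P (subst (_∈ P) cx≡cy x∈P))
    ... | no _     | no _     = cx≡cy

  walk-⇝ : ∀ {P : Subset n} {u v} → Walk Γ u v → u ∈ P → v ∉ P → P ⇝ P [ u ↦ v ]
  walk-⇝ here u∈P u∉P = ⊥-elim (u∉P u∈P)
  -- If the next vertex w is occupied, first move w's point on to v, then slide u into w.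
  walk-⇝ {P} {u} {v} (step {v = w} u~w walk) u∈P v∉P with w ∈? P
  ... | yes w∈P =
    ⇝-trans (walk-⇝ walk w∈P v∉P)
      (subst (P [ w ↦ v ] ⇝_) (P[w↦v][u↦w]≡P[u↦v] u∈P w∈P v∉P u≢w)
        (collapse-⇝ u~w (∈-↦-kept v u∈P u≢w) w∉P[w↦v]))
    where
    u≢w : u ≢ w
    u≢w refl = irrefl Γ u~w

    w∉P[w↦v] : w ∉ P [ w ↦ v ]
    w∉P[w↦v] w∈ with ∈-↦⁻ w∈
    ... | inj₁ refl = v∉P w∈P
    ... | inj₂ (_ , w≢w) = w≢w refl
  ... | no w∉P with w ≟ v
  ...   | yes refl = collapse-⇝ u~w u∈P w∉P
  ...   | no w≢v =
    ⇝-trans (collapse-⇝ u~w u∈P w∉P)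
      (subst (P [ u ↦ w ] ⇝_) (P[u↦w][w↦v]≡P[u↦v] w∉P)
        (walk-⇝ walk (∈-↦-target P u w) v∉P[u↦w]))
    where
    v∉P[u↦w] : v ∉ P [ u ↦ w ]
    v∉P[u↦w] v∈ with ∈-↦⁻ v∈
    ... | inj₁ refl = w≢v refl
    ... | inj₂ (v∈P , _) = v∉P v∈P

  ⇝-of-equal-size : Connected Γ → ∀ {P R : Subset n} → ∣ P ∣ ≡ ∣ R ∣ → P ⇝ R
  ⇝-of-equal-size conn {P} {R} = go P (<-wellFounded ∣ P ─ R ∣)
    where
    go : ∀ P → Acc _<_ ∣ P ─ R ∣ → ∣ P ∣ ≡ ∣ R ∣ → P ⇝ R
    go P (acc rec) ∣P∣≡∣R∣ with nonempty? (P ─ R)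
    ... | no P─R≡∅ =
      let P⊆R = Empty[p─q]⇒p⊆q P─R≡∅
      in  ⇝-reflexive (⊆-antisym P⊆R (p⊆q∧∣p∣≡∣q∣⇒q⊆p P⊆R ∣P∣≡∣R∣))
    ... | yes (u , u∈P─R) with nonempty? (R ─ P)
    ...   | no R─P≡∅ =
      let R⊆P = Empty[p─q]⇒p⊆q R─P≡∅
      in  ⊥-elim (x∈p─q⇒x∉q u∈P─R (p⊆q∧∣p∣≡∣q∣⇒q⊆p R⊆P (sym ∣P∣≡∣R∣) (p─q⊆p P R u∈P─R)))
    ...   | yes (v , v∈R─P) =
      ⇝-trans (walk-⇝ (conn u v) u∈P v∉P)
        (go (P [ u ↦ v ]) (rec ∣P[u↦v]─R∣<∣P─R∣) (trans (∣P[u↦v]∣≡∣P∣ u∈P v∉P) ∣P∣≡∣R∣))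
      where
      u∈P : u ∈ P
      u∈P = p─q⊆p P R u∈P─R

      v∉P : v ∉ P
      v∉P = x∈p─q⇒x∉q v∈R─P

      P[u↦v]─R⊆P─R-u : P [ u ↦ v ] ─ R ⊆ (P ─ R) - u
      P[u↦v]─R⊆P─R-u y∈ with ∈-↦⁻ (p─q⊆p (P [ u ↦ v ]) R y∈)
      ... | inj₁ refl = ⊥-elim (x∈p─q⇒x∉q y∈ (p─q⊆p R P v∈R─P))
      ... | inj₂ (y∈P , y≢u) = x∈p∧x≢y⇒x∈p-y (x∈p∧x∉q⇒x∈p─q y∈P (x∈p─q⇒x∉q y∈)) y≢u

      ∣P[u↦v]─R∣<∣P─R∣ : ∣ P [ u ↦ v ] ─ R ∣ < ∣ P ─ R ∣
      ∣P[u↦v]─R∣<∣P─R∣ = ≤-<-trans (p⊆q⇒∣p∣≤∣q∣ P[u↦v]─R⊆P─R-u) (x∈p⇒∣p-x∣<∣p∣ u∈P─R)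

  transfer : Connected Γ → ∀ {V U : Subset n} → ∣ V ∣ ≡ ∣ U ∣ → ∀ {a b} → a ∉ V → b ∈ V →
             ∃ λ t → InFlow Γ t × (∀ y → t y ∉ U) × BijectionOn t (_∉ V) (_∉ U)
  transfer conn {V} {U} ∣V∣≡∣U∣ {a} {b} a∉V b∈V
    with retraction conn (a , x∉p⇒x∈∁p a∉V) | ⇝-of-equal-size conn ∣∁V∣≡∣∁U∣
    where
    ∣∁V∣≡∣∁U∣ : ∣ ∁ V ∣ ≡ ∣ ∁ U ∣
    ∣∁V∣≡∣∁U∣ = trans (∣∁p∣≡n∸∣p∣ V) (trans (cong (n ∸_) ∣V∣≡∣U∣) (sym (∣∁p∣≡n∸∣p∣ U)))
  ... | r , r-flow , r-fix , r∈∁V | t , t-flow , t-bij =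
    t ∘ r , InFlow¹⇒InFlow (InFlow¹-comp r-flow t-flow) tr≢id ,
    (λ y → x∈∁p⇒x∉p (into t-bij (r∈∁V y))) , BijectionOn-∁ tr-bij
    where
    tr-bij : BijectionOn (t ∘ r) (_∈ ∁ V) (_∈ ∁ U)
    tr-bij = BijectionOn-comp (BijectionOn-fixed r-fix) t-bij

    -- Were t r the identity, b ∈ V would lie in t r (V) ⊆ ∁ U = t r (∁ V).
    tr≢id : ¬ (∀ x → t (r x) ≡ x)
    tr≢id tr≗id =
      let x , x∈∁V , trx≡b = onto tr-bij _ (subst (_∈ ∁ U) (tr≗id b) (into t-bij (r∈∁V b)))
      in  x∈∁p⇒x∉p x∈∁V (subst (_∈ V) (trans (sym trx≡b) (tr≗id x)) b∈V)

-- Defect groups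

module _ {Γ : Graph n} {Vk : Subset n} where

  isDefectGen : ∀ {s} → InFlow Γ s → (∀ x → s x ∉ Vk) → Surjects s (_∉ Vk) (_∉ Vk) →
              IsDefectGen Γ Vk s
  isDefectGen s-flow s∉Vk s-onto = s-flow , (λ x _ → s∉Vk x) , s-onto , (λ x _ → s∉Vk x)

  isDefectGen-∉ : ∀ {s} → IsDefectGen Γ Vk s → ∀ x → s x ∉ Vk
  isDefectGen-∉ (_ , outside↦outside , _ , inside↦outside) x with x ∈? Vk
  ... | yes x∈Vk = inside↦outside x x∈Vk
  ... | no x∉Vk = outside↦outside x x∉Vk

  defectGroup-∉ : ∀ {g} → InDefectGroup Γ Vk g → ∀ x → x ∉ Vk → g x ∉ Vk
  defectGroup-∉ (gen (_ , outside↦outside , _)) = outside↦outside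
  defectGroup-∉ one x x∉Vk = x∉Vk
  defectGroup-∉ (comp g∈G h∈G) x x∉Vk = defectGroup-∉ h∈G _ (defectGroup-∉ g∈G x x∉Vk)
  defectGroup-∉ (inv _ h∉Vk _) = h∉Vk
  defectGroup-∉ (resp g∈G h≗g) x x∉Vk = subst (_∉ Vk) (sym (h≗g x x∉Vk)) (defectGroup-∉ g∈G x x∉Vk)

  inverse : ∀ {g} → InDefectGroup Γ Vk g → BijectionOn g (_∉ Vk) (_∉ Vk) →
            ∃ λ h → InDefectGroup Γ Vk h × (∀ y → y ∉ Vk → h y ∉ Vk × g (h y) ≡ y)
  inverse {g} g∈G g-bij = h , inv g∈G (λ y y∉Vk → proj₁ (h-spec y y∉Vk)) h∘g≗id , h-spec
    where
    h : Transf n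
    h y with y ∈? Vk
    ... | yes _ = y
    ... | no y∉Vk = proj₁ (onto g-bij y y∉Vk)

    h-spec : ∀ y → y ∉ Vk → h y ∉ Vk × g (h y) ≡ y
    h-spec y y∉Vk with y ∈? Vk
    ... | yes y∈Vk = ⊥-elim (y∉Vk y∈Vk)
    ... | no y∉Vk′ = proj₂ (onto g-bij y y∉Vk′)

    h∘g≗id : ∀ x → x ∉ Vk → h (g x) ≡ x
    h∘g≗id x x∉Vk =
      let hgx∉Vk , ghgx≡gx = h-spec (g x) (into g-bij x∉Vk)
      in  injective g-bij hgx∉Vk x∉Vk ghgx≡gx

image? : ∀ (φ : Fin m → Fin n) (W : Subset m) y → Dec (∃ λ x → x ∉ W × φ x ≡ y)
image? φ W y = any? λ x → ¬? (x ∈? W) ×-dec (φ x ≟ y)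

Realized : Graph n → Subset n → Subset m → (Fin m → Fin n) → Transf m → Set
Realized {n} Γ Vk W φ g' =
  Σ (Transf n) λ g → InDefectGroup Γ Vk g
    × (∀ x → x ∉ W → g (φ x) ≡ φ (g' x))
    × (∀ y → y ∉ Vk → (∀ x → x ∉ W → φ x ≢ y) → g y ≡ y)

module _ {Γ : Graph n} {Vk : Subset n} {Γ' : Graph m} {W : Subset m} {φ : Fin m → Fin n}
         (φ-∉ : ∀ x → x ∉ W → φ x ∉ Vk)
         (φ-inj : ∀ x y → x ∉ W → y ∉ W → φ x ≡ φ y → x ≡ y) where

  pushforward : Transf m → Transf n
  pushforward h' y with image? φ W y
  ... | yes (x , _ , _) = φ (h' x)
  ... | no _ = y

  pushforward-φ : ∀ h' x → x ∉ W → pushforward h' (φ x) ≡ φ (h' x)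
  pushforward-φ h' x x∉W with image? φ W (φ x)
  ... | yes (x′ , x′∉W , φx′≡φx) = cong (φ ∘ h') (φ-inj x′ x x′∉W x∉W φx′≡φx)
  ... | no off = ⊥-elim (off (x , x∉W , refl))

  pushforward-off : ∀ h' {y} → ¬ (∃ λ x → x ∉ W × φ x ≡ y) → pushforward h' y ≡ y
  pushforward-off h' {y} off with image? φ W y
  ... | yes on = ⊥-elim (off on)
  ... | no _ = refl

  realize-group : (∀ s' → IsDefectGen Γ' W s' → Realized Γ Vk W φ s') →
                  ∀ g' → InDefectGroup Γ' W g' → Realized Γ Vk W φ g'
  realize-group realize-gen g' (gen s'-gen) = realize-gen g' s'-gen
  realize-group realize-gen .id one = id , one , (λ _ _ → refl) , (λ _ _ _ → refl)
  realize-group realize-gen .(h' ∘ g') (comp {g'} {h'} g'∈G h'∈G)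
    with realize-group realize-gen g' g'∈G | realize-group realize-gen h' h'∈G
  ... | g , g∈G , g-φ , g-fix | h , h∈G , h-φ , h-fix =
    h ∘ g , comp g∈G h∈G ,
    (λ x x∉W → trans (cong h (g-φ x x∉W)) (h-φ (g' x) (defectGroup-∉ g'∈G x x∉W))) ,
    (λ y y∉Vk off → trans (cong h (g-fix y y∉Vk off)) (h-fix y y∉Vk off))
  realize-group realize-gen h' (inv {g'} g'∈G h'∉W h'∘g'≗id) with realize-group realize-gen g' g'∈G
  ... | g , g∈G , g-φ , g-fix =
    h , inv g∈G h∉Vk h∘g≗id , pushforward-φ h' ,
    (λ y _ off → pushforward-off h' λ (x , x∉W , φx≡y) → off x x∉W φx≡y)
    where
    h : Transf n
    h = pushforward h'

    h∉Vk : ∀ y → y ∉ Vk → h y ∉ Vk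
    h∉Vk y y∉Vk with image? φ W y
    ... | yes (x , x∉W , _) = φ-∉ (h' x) (h'∉W x x∉W)
    ... | no _ = y∉Vk

    h∘g≗id : ∀ y → y ∉ Vk → h (g y) ≡ y
    h∘g≗id y y∉Vk with image? φ W y
    ... | yes (x , x∉W , refl) =
      trans (cong h (g-φ x x∉W))
        (trans (pushforward-φ h' (g' x) (defectGroup-∉ g'∈G x x∉W)) (cong φ (h'∘g'≗id x x∉W)))
    ... | no off =
      trans (cong h (g-fix y y∉Vk λ x x∉W φx≡y → off (x , x∉W , φx≡y))) (pushforward-off h' off)
  realize-group realize-gen h' (resp {g'} g'∈G h'≗g') with realize-group realize-gen g' g'∈G
  ... | g , g∈G , g-φ , g-fix =
    g , g∈G , (λ x x∉W → trans (g-φ x x∉W) (cong φ (sym (h'≗g' x x∉W)))) , g-fix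

containsPermCopy-trans : ∀ {l} {Γ₁ : Graph n} {V₁ : Subset n} {Γ₂ : Graph m} {V₂ : Subset m}
                           {Γ₃ : Graph l} {V₃ : Subset l} →
                         ContainsPermCopy Γ₁ V₁ Γ₂ V₂ → ContainsPermCopy Γ₂ V₂ Γ₃ V₃ →
                         ContainsPermCopy Γ₁ V₁ Γ₃ V₃
containsPermCopy-trans {V₁ = V₁} {V₂ = V₂} {V₃ = V₃}
                       (φ , φ-∉ , φ-inj , φ-real) (χ , χ-∉ , χ-inj , χ-real) =
  φ ∘ χ , (λ x x∉V₃ → φ-∉ (χ x) (χ-∉ x x∉V₃)) ,
  (λ x y x∉V₃ y∉V₃ e → χ-inj x y x∉V₃ y∉V₃ (φ-inj _ _ (χ-∉ x x∉V₃) (χ-∉ y y∉V₃) e)) ,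
  realized
  where
  realized : ∀ g'' → InDefectGroup _ V₃ g'' → Realized _ V₁ V₃ (φ ∘ χ) g''
  realized g'' g''∈G with χ-real g'' g''∈G
  ... | g' , g'∈G , g'-χ , g'-fix with φ-real g' g'∈G
  ...   | g , g∈G , g-φ , g-fix = g , g∈G , g-φχ , g-fix′
    where
    g-φχ : ∀ x → x ∉ V₃ → g (φ (χ x)) ≡ φ (χ (g'' x))
    g-φχ x x∉V₃ = trans (g-φ (χ x) (χ-∉ x x∉V₃)) (cong φ (g'-χ x x∉V₃))

    g-fix′ : ∀ y → y ∉ V₁ → (∀ x → x ∉ V₃ → φ (χ x) ≢ y) → g y ≡ y
    g-fix′ y y∉V₁ off with image? φ V₂ y
    ... | no off-φ = g-fix y y∉V₁ λ z z∉V₂ φz≡y → off-φ (z , z∉V₂ , φz≡y)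
    ... | yes (z , z∉V₂ , refl) =
      trans (g-φ z z∉V₂) (cong φ (g'-fix z z∉V₂ λ x x∉V₃ χx≡z → off x x∉V₃ (cong φ χx≡z)))

module _ {Γ : Graph n} (conn : Connected Γ) where

  containsPermCopy-change-of-base : ∀ {Vk U : Subset n} → ∣ Vk ∣ ≡ ∣ U ∣ →
                                    ∀ {z₀ z₁} → z₀ ∉ U → z₁ ∈ U → ContainsPermCopy Γ Vk Γ U
  containsPermCopy-change-of-base {Vk} {U} ∣Vk∣≡∣U∣ z₀∉U z₁∈U
    with ∣p∣<n⇒∃∉ {p = Vk} (subst (_< n) (sym ∣Vk∣≡∣U∣) (x∉p⇒∣p∣<n z₀∉U))
       | 0<∣p∣⇒Nonempty {p = Vk} (subst (0 <_) (sym ∣Vk∣≡∣U∣) (x∈p⇒0<∣p∣ z₁∈U))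
  ... | _ , a∉Vk | _ , b∈Vk
    with transfer conn ∣Vk∣≡∣U∣ a∉Vk b∈Vk | transfer conn (sym ∣Vk∣≡∣U∣) z₀∉U z₁∈U
  ... | t , t-flow , t∉U , t-bij | ψ , ψ-flow , ψ∉Vk , ψ-bij =
    ψ , (λ z _ → ψ∉Vk z) , (λ _ _ → injective ψ-bij) ,
    realize-group (λ z _ → ψ∉Vk z) (λ _ _ → injective ψ-bij) realize-gen
    where
    p-bij : BijectionOn (ψ ∘ t) (_∉ Vk) (_∉ Vk)
    p-bij = BijectionOn-comp t-bij ψ-bij

    p∈G : InDefectGroup Γ Vk (ψ ∘ t)
    p∈G = gen (isDefectGen (comp t-flow ψ-flow) (ψ∉Vk ∘ t) (onto p-bij))

    -- With p = ψ t, the element (ψ r t) p⁻¹ acts on ∁ Vk as ψ r ψ⁻¹.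
    realize-gen : ∀ r → IsDefectGen Γ U r → Realized Γ Vk U ψ r
    realize-gen r (r-flow , _ , r-onto , _) with inverse p∈G p-bij
    ... | p⁻¹ , p⁻¹∈G , p⁻¹-spec =
      g₀ ∘ p⁻¹ , comp p⁻¹∈G (gen g₀-gen) , g-ψ , λ y y∉Vk off → ⊥-elim (ψ-onto-off y∉Vk off)
      where
      g₀ : Transf n
      g₀ = ψ ∘ r ∘ t

      g₀-gen : IsDefectGen Γ Vk g₀
      g₀-gen = isDefectGen (comp (comp t-flow r-flow) ψ-flow) (ψ∉Vk ∘ r ∘ t)
                 (Surjects-comp (onto t-bij) (Surjects-comp r-onto (onto ψ-bij)))

      g-ψ : ∀ z → z ∉ U → g₀ (p⁻¹ (ψ z)) ≡ ψ (r z)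
      g-ψ z z∉U =
        let _ , ψtp⁻¹ψz≡ψz = p⁻¹-spec (ψ z) (ψ∉Vk z)
        in  cong (ψ ∘ r) (injective ψ-bij (t∉U _) z∉U ψtp⁻¹ψz≡ψz)

      ψ-onto-off : ∀ {y} → y ∉ Vk → ¬ (∀ z → z ∉ U → ψ z ≢ y)
      ψ-onto-off y∉Vk off = let z , z∉U , ψz≡y = onto ψ-bij _ y∉Vk in off z z∉U ψz≡y

-- Subgraphs

walk-crosses : ∀ {Γ : Graph n} {P : Fin n → Set} → (∀ z → Dec (P z)) →
               ∀ {a b} → Walk Γ a b → ¬ P a → P b → ∃ λ u → ∃ λ v → ¬ P u × P v × Edge Γ u v
walk-crosses P? here ¬Pa Pb = ⊥-elim (¬Pa Pb)
walk-crosses P? {a} (step {v = w} a~w walk) ¬Pa Pb with P? w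
... | yes Pw = a , w , ¬Pa , Pw , a~w
... | no ¬Pw = walk-crosses P? walk ¬Pw Pb

module _ {Γ' : Graph m} {Γ : Graph n} (sub : Subgraph Γ' Γ) where

  private
    ιₛ : Fin m → Fin n
    ιₛ = ι sub

  flow-extension : ∀ {s} → InFlow Γ' s →
                   ∃ λ r → InFlow Γ r × (∀ x → r (ιₛ x) ≡ ιₛ (s x))
                                      × (∀ z → (∀ x → ιₛ x ≢ z) → r z ≡ z)
  flow-extension (gen {u} {v} u~v) =
    collapse (ιₛ u) (ιₛ v) , gen (ι-edge sub u~v) , commutes , fixes
    where
    commutes : ∀ x → collapse (ιₛ u) (ιₛ v) (ιₛ x) ≡ ιₛ (collapse u v x)
    commutes x with x ≟ u
    ... | yes refl = collapse-source (ιₛ x) (ιₛ v)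
    ... | no x≢u = collapse-fixes (ιₛ v) (x≢u ∘ ι-inj sub)

    fixes : ∀ z → (∀ x → ιₛ x ≢ z) → collapse (ιₛ u) (ιₛ v) z ≡ z
    fixes z off = collapse-fixes (ιₛ v) (off u ∘ sym)
  flow-extension (comp s-flow t-flow) with flow-extension s-flow | flow-extension t-flow
  ... | r , r-flow , r-ι , r-fix | r′ , r′-flow , r′-ι , r′-fix =
    r′ ∘ r , comp r-flow r′-flow , (λ x → trans (cong r′ (r-ι x)) (r′-ι _)) ,
    (λ z off → trans (cong r′ (r-fix z off)) (r′-fix z off))

  Extension : Subset n → Transf m → Set
  Extension U s' =
    ∃ λ r → InFlow Γ r × (∀ z → r z ∉ U) × (∀ x → r (ιₛ x) ≡ ιₛ (s' x))
                       × (∀ z → z ∉ U → (∀ x → ιₛ x ≢ z) → r z ≡ z)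

  containsPermCopy-of-extensions :
    ∀ {W : Subset m} {U : Subset n} → (∀ x → x ∈ W → ιₛ x ∈ U) → (∀ x → x ∉ W → ιₛ x ∉ U) →
    (∀ {s'} → IsDefectGen Γ' W s' → Extension U s') → ContainsPermCopy Γ U Γ' W
  containsPermCopy-of-extensions {W} {U} ι-W ι-∁W extend =
    ιₛ , ι-∁W , (λ _ _ _ _ → ι-inj sub) , realize-group ι-∁W (λ _ _ _ _ → ι-inj sub) realize-gen
    where
    realize-gen : ∀ s' → IsDefectGen Γ' W s' → Realized Γ U W ιₛ s'
    realize-gen s' s'-gen@(_ , _ , s'-onto , _) with extend s'-gen
    ... | r , r-flow , r∉U , r-ι , r-fix =
      r , gen (isDefectGen r-flow r∉U r-onto) , (λ x _ → r-ι x) , fix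
      where
      r-onto : Surjects r (_∉ U) (_∉ U)
      r-onto y y∉U with any? (λ x → ιₛ x ≟ y)
      ... | no off = y , y∉U , r-fix y y∉U (λ x ιx≡y → off (x , ιx≡y))
      ... | yes (x , refl) with x ∈? W
      ...   | yes x∈W = ⊥-elim (y∉U (ι-W x x∈W))
      ...   | no x∉W = let x′ , x′∉W , s'x′≡x = s'-onto x x∉W
                       in  ιₛ x′ , ι-∁W x′ x′∉W , trans (r-ι x′) (cong ιₛ s'x′≡x)

      fix : ∀ y → y ∉ U → (∀ x → x ∉ W → ιₛ x ≢ y) → r y ≡ y
      fix y y∉U off = r-fix y y∉U λ x ιx≡y → case x ∈? W of λ
        { (yes x∈W) → y∉U (subst (_∈ U) ιx≡y (ι-W x x∈W))
        ; (no x∉W) → off x x∉W ιx≡y }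

  ι-image? : ∀ z → (∃ λ x → ιₛ x ≡ z) ⊎ (∀ x → ιₛ x ≢ z)
  ι-image? z with any? (λ x → ιₛ x ≟ z)
  ... | yes on = inj₁ on
  ... | no off = inj₂ λ x ιx≡z → off (x , ιx≡z)

  ι∈image⇒∈ : ∀ {W x} → ιₛ x ∈ image ιₛ W → x ∈ W
  ι∈image⇒∈ {W} ιx∈ =
    let x′ , x′∈W , ιx′≡ιx = ∈-image⁻ ιₛ ιx∈ in subst (_∈ W) (ι-inj sub ιx′≡ιx) x′∈W

  off-ι⇒∉image : ∀ {W z} → (∀ x → ιₛ x ≢ z) → z ∉ image ιₛ W
  off-ι⇒∉image {W} off z∈ = let x , _ , ιx≡z = ∈-image⁻ ιₛ {W} z∈ in off x ιx≡z

  extension-image : ∀ {W s'} → IsDefectGen Γ' W s' → Extension (image ιₛ W) s'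
  extension-image {W} s'-gen@(s'-flow , _) with flow-extension s'-flow
  ... | r , r-flow , r-ι , r-fix = r , r-flow , r∉U , r-ι , (λ z _ → r-fix z)
    where
    r∉U : ∀ z → r z ∉ image ιₛ W
    r∉U z with ι-image? z
    ... | inj₁ (x , refl) = subst (_∉ image ιₛ W) (sym (r-ι x)) (isDefectGen-∉ s'-gen x ∘ ι∈image⇒∈)
    ... | inj₂ off = subst (_∉ image ιₛ W) (sym (r-fix z off)) (off-ι⇒∉image {W} off)

  containsPermCopy-image : ∀ W → ContainsPermCopy Γ (image ιₛ W) Γ' W
  containsPermCopy-image W =
    containsPermCopy-of-extensions (λ x → ∈-image⁺ ιₛ) (λ x x∉W → x∉W ∘ ι∈image⇒∈) extension-image

  module _ {w y₀} (w-off : ∀ x → ιₛ x ≢ w) (w~ιy₀ : Edge Γ w (ιₛ y₀)) where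

    ι∉neighbour∪image : ∀ {W x} → x ∉ W → ιₛ x ∉ ⁅ w ⁆ ∪ image ιₛ W
    ι∉neighbour∪image {W} {x} x∉W = x≢y∧x∉p⇒x∉⁅y⁆∪p (w-off x) (x∉W ∘ ι∈image⇒∈)

    extension-neighbour∪image : ∀ {W s'} → IsDefectGen Γ' W s' → Extension (⁅ w ⁆ ∪ image ιₛ W) s'
    extension-neighbour∪image {W} {s'} s'-gen@(s'-flow , _) with flow-extension s'-flow
    ... | r , r-flow , r-ι , r-fix =
      r ∘ collapse w (ιₛ y₀) , comp (gen w~ιy₀) r-flow , r′∉U , r′-ι , r′-fix
      where
      U : Subset n
      U = ⁅ w ⁆ ∪ image ιₛ W

      r-ι∉U : ∀ x → r (ιₛ x) ∉ U
      r-ι∉U x = subst (_∉ U) (sym (r-ι x)) (ι∉neighbour∪image (isDefectGen-∉ s'-gen x))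

      r′∉U : ∀ z → r (collapse w (ιₛ y₀) z) ∉ U
      r′∉U z with z ≟ w
      ... | yes refl = r-ι∉U y₀
      ... | no z≢w with ι-image? z
      ...   | inj₁ (x , refl) = r-ι∉U x
      ...   | inj₂ off =
        subst (_∉ U) (sym (r-fix z off)) (x≢y∧x∉p⇒x∉⁅y⁆∪p z≢w (off-ι⇒∉image {W} off))

      r′-ι : ∀ x → r (collapse w (ιₛ y₀) (ιₛ x)) ≡ ιₛ (s' x)
      r′-ι x = trans (cong r (collapse-fixes (ιₛ y₀) (w-off x))) (r-ι x)

      r′-fix : ∀ z → z ∉ U → (∀ x → ιₛ x ≢ z) → r (collapse w (ιₛ y₀) z) ≡ z
      r′-fix z z∉U off =
        trans (cong r (collapse-fixes (ιₛ y₀) λ { refl → z∉U (x∈p∪q⁺ (inj₁ (x∈⁅x⁆ w))) }))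
              (r-fix z off)

    containsPermCopy-neighbour∪image : ∀ W → ContainsPermCopy Γ (⁅ w ⁆ ∪ image ιₛ W) Γ' W
    containsPermCopy-neighbour∪image W =
      containsPermCopy-of-extensions (λ x x∈W → x∈p∪q⁺ (inj₂ (∈-image⁺ ιₛ x∈W)))
        (λ x → ι∉neighbour∪image) extension-neighbour∪image

module _ {Γ : Graph n} {Γ' : Graph m} (conn : Connected Γ) (sub : Subgraph Γ' Γ) where

  containsPermCopy-equal-defect : ∀ {Vk : Subset n} {W : Subset m} →
                                  ∣ Vk ∣ ≡ ∣ W ∣ → 0 < ∣ W ∣ → ∣ W ∣ < m →
                                  ContainsPermCopy Γ Vk Γ' W
  containsPermCopy-equal-defect {Vk} {W} ∣Vk∣≡∣W∣ 0<∣W∣ ∣W∣<m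
    with ∣p∣<n⇒∃∉ {p = W} ∣W∣<m | 0<∣p∣⇒Nonempty {p = W} 0<∣W∣
  ... | x₀ , x₀∉W | x₁ , x₁∈W =
    containsPermCopy-trans
      (containsPermCopy-change-of-base conn {Vk} {image (ι sub) W} ∣Vk∣≡∣image∣
         (x₀∉W ∘ ι∈image⇒∈ sub) (∈-image⁺ (ι sub) x₁∈W))
      (containsPermCopy-image sub W)
    where
    ∣Vk∣≡∣image∣ : ∣ Vk ∣ ≡ ∣ image (ι sub) W ∣
    ∣Vk∣≡∣image∣ = trans ∣Vk∣≡∣W∣ (sym (∣image∣≡∣p∣ (ι-inj sub) W))

  containsPermCopy-smaller-defect : (∃ λ w → ∀ x → ι sub x ≢ w) →
                                    ∀ {Vk : Subset n} {W : Subset m} →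
                                    ∣ Vk ∣ ≡ suc ∣ W ∣ → ∣ W ∣ < m →
                                    ContainsPermCopy Γ Vk Γ' W
  containsPermCopy-smaller-defect (w , w-off) {Vk} {W} ∣Vk∣≡1+∣W∣ ∣W∣<m with ∣p∣<n⇒∃∉ {p = W} ∣W∣<m
  ... | x₀ , x₀∉W
    with walk-crosses (λ z → any? λ x → ι sub x ≟ z) (conn w (ι sub x₀))
           (λ (x , ιx≡w) → w-off x ιx≡w) (x₀ , refl)
  ... | w′ , _ , w′-off , (y₀ , refl) , w′~ιy₀ =
    containsPermCopy-trans
      (containsPermCopy-change-of-base conn {Vk} {⁅ w′ ⁆ ∪ image (ι sub) W} ∣Vk∣≡∣U∣
         (ι∉neighbour∪image sub w′-off′ w′~ιy₀ x₀∉W) (x∈p∪q⁺ (inj₁ (x∈⁅x⁆ w′))))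
      (containsPermCopy-neighbour∪image sub w′-off′ w′~ιy₀ W)
    where
    w′-off′ : ∀ x → ι sub x ≢ w′
    w′-off′ x ιx≡w′ = w′-off (x , ιx≡w′)

    ∣Vk∣≡∣U∣ : ∣ Vk ∣ ≡ ∣ ⁅ w′ ⁆ ∪ image (ι sub) W ∣
    ∣Vk∣≡∣U∣ = trans ∣Vk∣≡1+∣W∣ (sym (trans (x∉p⇒∣⁅x⁆∪p∣≡1+∣p∣ (off-ι⇒∉image sub {W} w′-off′))
                                           (cong suc (∣image∣≡∣p∣ (ι-inj sub) W))))

lemma5p1 : ∀ (k : ℕ) → 2 ≤ k
    → ∀ {n m : ℕ} (Γ : Graph n) (Γ' : Graph m)
    → Connected Γ → Connected Γ' → (sub : Subgraph Γ' Γ)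
    → (k + 1 ≤ m
        → ∀ (Vk : Subset n) → ∣ Vk ∣ ≡ k
        → ∀ (W : Subset m) → ∣ W ∣ ≡ k
        → ContainsPermCopy Γ Vk Γ' W)
    × ((∃ λ (w : Fin n) → ∀ (x : Fin m) → ι sub x ≢ w)
        → k ≤ m
        → ∀ (Vk : Subset n) → ∣ Vk ∣ ≡ k
        → ∀ (W : Subset m) → ∣ W ∣ ≡ k ∸ 1
        → ContainsPermCopy Γ Vk Γ' W)
lemma5p1 zero ()
lemma5p1 (suc k) (s≤s _) {m = m} Γ Γ' conn _ sub =
  (λ k+2≤m Vk ∣Vk∣≡1+k W ∣W∣≡1+k →
     containsPermCopy-equal-defect conn sub {Vk} {W} (trans ∣Vk∣≡1+k (sym ∣W∣≡1+k))
       (subst (0 <_) (sym ∣W∣≡1+k) (s≤s z≤n))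
       (subst (_< m) (sym ∣W∣≡1+k) (subst (_≤ m) (+-comm (suc k) 1) k+2≤m))) ,
  (λ off k+1≤m Vk ∣Vk∣≡1+k W ∣W∣≡k →
     containsPermCopy-smaller-defect conn sub off {Vk} {W} (trans ∣Vk∣≡1+k (cong suc (sym ∣W∣≡k)))
       (subst (_< m) (sym ∣W∣≡k) k+1≤m))
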